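{- Let $G$ be a finite simple graph that contains a subdivision of $K_4^-$ as a subgraph. Then $S(G)$ contains a subdivision of $K_{3,3}$ as a subgraph.
   Context: $K_4^-$ denotes the complete graph $K_4$ with one edge removed (the diamond graph). For a graph $G$, the great shadow $S(G)$ is obtained from $G$ by introducing, for each vertex $v$, a new vertex $v'$ (the shadow vertex of $v$) adjacent to $v$ and to every neighbor of $v$ in $G$; $S(G)$ contains all edges of $G$ and no edges between shadow vertices. A subdivision of a graph $H$ is a graph obtained from $H$ by replacing edges with internally vertex-disjoint paths. -}

module Defs where

open import Level using (Level; 0ℓ)
open import Data.Nat using (ℕ; zero; suc)
open import Data.Fin using (Fin; zero; suc; _<_)
open import Data.Sum using (_⊎_; inj₁; inj₂)
open import Data.Product using (Σ; _×_; _,_)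
open import Data.Empty using (⊥)
open import Data.Unit using (⊤)
open import Data.List using (List; []; _∷_)
open import Data.List.Membership.Propositional using (_∈_)
open import Data.List.Relation.Unary.Unique.Propositional using (Unique)
open import Relation.Nullary using (¬_)
open import Relation.Binary.PropositionalEquality using (_≡_)
open import Function.Definitions using (Injective)

record Graph (V : Set) : Set₁ where
  field
    Adj   : V → V → Set
    sym   : ∀ {u v} → Adj u v → Adj v u
    irrefl : ∀ {v} → ¬ Adj v v
open Graph public

FinGraph : ℕ → Set₁
FinGraph n = Graph (Fin n)

-- The great shadow S(G): vertices inj₁ v (original) and inj₂ v (shadow v').
-- Edges: all edges of G; v' ~ v; v' ~ w for every neighbour w of v;
-- no edges between shadow vertices.
ShAdj : {V : Set} → Graph V → V ⊎ V → V ⊎ V → Set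
ShAdj G (inj₁ u) (inj₁ v) = Adj G u v
ShAdj G (inj₁ u) (inj₂ v) = (v ≡ u) ⊎ Adj G v u
ShAdj G (inj₂ u) (inj₁ v) = (u ≡ v) ⊎ Adj G u v
ShAdj G (inj₂ u) (inj₂ v) = ⊥

shadow : {V : Set} → Graph V → Graph (V ⊎ V)
shadow G = record { Adj = ShAdj G ; sym = λ {u} {v} → s {u} {v} ; irrefl = λ {v} → i {v} }
  where
  s : ∀ {u v} → ShAdj G u v → ShAdj G v u
  s {inj₁ u} {inj₁ v} a = sym G a
  s {inj₁ u} {inj₂ v} a = a
  s {inj₂ u} {inj₁ v} a = a
  s {inj₂ u} {inj₂ v} ()
  i : ∀ {v} → ¬ ShAdj G v v
  i {inj₁ v} a = irrefl G a
  i {inj₂ v} ()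

WalkThrough : {V : Set} → Graph V → V → List V → V → Set
WalkThrough G a []       b = Adj G a b
WalkThrough G a (x ∷ xs) b = Adj G a x × WalkThrough G x xs b

Disjoint : {V : Set} → List V → List V → Set
Disjoint xs ys = ∀ {x} → x ∈ xs → ¬ (x ∈ ys)

-- G contains a subdivision of H (H on Fin h) as a subgraph:
-- an injective placement of the branch vertices, and for each edge {u,v}
-- of H (u < v) a path in G from φ u to φ v, given by its list of internal
-- vertices, such that the path is simple (internal vertices distinct and
-- not branch vertices) and paths of distinct edges are internally disjoint.
record SubdivisionIn {V : Set} {h : ℕ} (H : FinGraph h) (G : Graph V) : Set where
  field
    φ        : Fin h → V
    φ-inj    : Injective _≡_ _≡_ φ
    path     : (u v : Fin h) → u < v → Adj H u v → List V
    walk     : ∀ u v (p : u < v) (e : Adj H u v) → WalkThrough G (φ u) (path u v p e) (φ v)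
    unique   : ∀ u v (p : u < v) (e : Adj H u v) → Unique (path u v p e)
    avoid    : ∀ u v (p : u < v) (e : Adj H u v) (w : Fin h) → ¬ (φ w ∈ path u v p e)
    disjoint : ∀ u v (p : u < v) (e : Adj H u v) u' v' (p' : u' < v') (e' : Adj H u' v') →
               ¬ ((u ≡ u') × (v ≡ v')) → Disjoint (path u v p e) (path u' v' p' e')

data K4⁻Adj : Fin 4 → Fin 4 → Set where
  e01 : K4⁻Adj zero (suc zero)
  e10 : K4⁻Adj (suc zero) zero
  e02 : K4⁻Adj zero (suc (suc zero))
  e20 : K4⁻Adj (suc (suc zero)) zero
  e12 : K4⁻Adj (suc zero) (suc (suc zero))
  e21 : K4⁻Adj (suc (suc zero)) (suc zero)
  e13 : K4⁻Adj (suc zero) (suc (suc (suc zero)))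
  e31 : K4⁻Adj (suc (suc (suc zero))) (suc zero)
  e23 : K4⁻Adj (suc (suc zero)) (suc (suc (suc zero)))
  e32 : K4⁻Adj (suc (suc (suc zero))) (suc (suc zero))

K4⁻ : FinGraph 4
K4⁻ = record { Adj = K4⁻Adj ; sym = s ; irrefl = i }
  where
  s : ∀ {u v} → K4⁻Adj u v → K4⁻Adj v u
  s e01 = e10
  s e10 = e01
  s e02 = e20
  s e20 = e02
  s e12 = e21
  s e21 = e12
  s e13 = e31
  s e31 = e13
  s e23 = e32
  s e32 = e23
  i : ∀ {v} → ¬ K4⁻Adj v v
  i ()

side : Fin 6 → Fin 2
side zero = zero
side (suc zero) = zero
side (suc (suc zero)) = zero
side (suc (suc (suc _))) = suc zero

K33Adj : Fin 6 → Fin 6 → Set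
K33Adj u v = ¬ (side u ≡ side v)

K33 : FinGraph 6
K33 = record { Adj = K33Adj ; sym = λ a eq → a (Relation.Binary.PropositionalEquality.sym eq) ; irrefl = λ a → a Relation.Binary.PropositionalEquality.refl }

{-# OPTIONS --safe #-}

-- In the diamond, the two branch vertices b and c of degree 3 are joined by three
-- internally disjoint paths: through a, through d, and along the edge bc.  In G this
-- is a theta graph with poles b, c.  Let x₁, x₂, x₃ be the neighbours of b on its
-- three paths.  In S(G) the shadow b′ is adjacent to every neighbour of b, and the
-- shadow c′ to c and every neighbour of c, so each xᵢ is adjacent to b and b′ and
-- reaches c′ along the rest of its path.  This is a subdivision of K₃,₃ with sides
-- {x₁, x₂, x₃} and {b, b′, c′}.

module Submission where

open import Defs
open import Data.Nat using (ℕ; z<s; s<s)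
open import Data.Fin using (Fin; suc; _<_; _≟_; _↑ˡ_; _↑ʳ_; splitAt; join)
open import Data.Fin.Patterns using (0F; 1F; 2F; 3F)
open import Data.Fin.Properties using (splitAt-↑ˡ; join-splitAt)
open import Data.Sum using (_⊎_; inj₁; inj₂; [_,_]′)
open import Data.Sum.Properties using (inj₁-injective; inj₂-injective)
open import Data.Maybe using (Maybe; just; nothing)
open import Data.Maybe.Properties using (just-injective)
open import Data.Product using (Σ; ∃; _×_; _,_; proj₁; proj₂)
open import Data.Empty using (⊥-elim)
open import Data.List using (List; []; _∷_; _++_; map; reverse)
open import Data.List.Properties using (unfold-reverse)
open import Data.List.Membership.Propositional using (_∈_; _∉_)
open import Data.List.Membership.Propositional.Properties using (∈-map⁻; ∈-++⁻; ∈-++⁺ʳ)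
open import Data.List.Relation.Unary.Any using (here; there)
open import Data.List.Relation.Unary.Any.Properties using (reverse⁻)
open import Data.List.Relation.Unary.All using ([])
open import Data.List.Relation.Unary.All.Properties.Core using (¬Any⇒All¬; All¬⇒¬Any)
open import Data.List.Relation.Unary.Unique.Propositional using (Unique; []; _∷_)
import Data.List.Relation.Unary.Unique.Propositional.Properties as Unique
import Data.List.Relation.Binary.Permutation.Setoid as Permutation
import Data.List.Relation.Binary.Permutation.Setoid.Properties as PermutationProperties
open import Function using (_∘_; case_of_)
open import Function.Definitions using (Injective)
open import Relation.Nullary using (¬_; yes; no)
import Relation.Binary.PropositionalEquality as ≡
open ≡ using (_≡_; _≢_; refl; cong; subst; ≢-sym)
open ≡.≡-Reasoning

Unique-reverse : {A : Set} {xs : List A} → Unique xs → Unique (reverse xs)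
Unique-reverse {A} {xs} = Unique-resp-↭ (↭-sym (↭-reverse xs))
  where
  open Permutation (≡.setoid A) using (↭-sym)
  open PermutationProperties (≡.setoid A) using (Unique-resp-↭; ↭-reverse)

Unique-++-∷ : {A : Set} {xs ys : List A} {m : A} →
              Unique xs → Unique ys → m ∉ ys → Disjoint xs (m ∷ ys) → Unique (xs ++ m ∷ ys)
Unique-++-∷ {ys = ys} xs! ys! m∉ys xs∩m∷ys =
  Unique.++⁺ xs! (¬Any⇒All¬ ys m∉ys ∷ ys!) λ (x∈xs , x∈m∷ys) → xs∩m∷ys x∈xs x∈m∷ys

∈-map-injective⁻ : {A B : Set} {f : A → B} {x : A} {xs : List A} →
                   Injective _≡_ _≡_ f → f x ∈ map f xs → x ∈ xs
∈-map-injective⁻ f-inj fx∈ with ∈-map⁻ _ fx∈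
... | y , y∈xs , fx≡fy = subst (_∈ _) (≡.sym (f-inj fx≡fy)) y∈xs

Disjoint-map⁺ : {A B : Set} {f : A → B} {xs ys : List A} →
                Injective _≡_ _≡_ f → Disjoint xs ys → Disjoint (map f xs) (map f ys)
Disjoint-map⁺ f-inj xs∩ys z∈fxs z∈fys with ∈-map⁻ _ z∈fxs
... | x , x∈xs , refl = xs∩ys x∈xs (∈-map-injective⁻ f-inj z∈fys)

Disjoint⇒≢ : {A : Set} {xs ys : List A} {x : A} → x ∈ xs → Disjoint xs ys → xs ≢ ys
Disjoint⇒≢ x∈xs xs∩ys refl = xs∩ys x∈xs x∈xs

module _ {V : Set} (G : Graph V) where

  walk-++ : ∀ {a m b} xs {ys} →
            WalkThrough G a xs m → WalkThrough G m ys b → WalkThrough G a (xs ++ m ∷ ys) b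
  walk-++ []       a~m       m⋯b = a~m , m⋯b
  walk-++ (x ∷ xs) (a~x , x⋯m) m⋯b = a~x , walk-++ xs x⋯m m⋯b

  walk-reverse : ∀ {a b} xs → WalkThrough G a xs b → WalkThrough G b (reverse xs) a
  walk-reverse []       a~b       = sym G a~b
  walk-reverse (x ∷ xs) (a~x , x⋯b) =
    subst (λ zs → WalkThrough G _ zs _) (≡.sym (unfold-reverse x xs))
          (walk-++ (reverse xs) (walk-reverse xs x⋯b) (sym G a~x))

record Path {V : Set} (G : Graph V) (s t : V) : Set where
  constructor mkPath
  field
    inner  : List V
    walk   : WalkThrough G s inner t
    unique : Unique inner
    s∉     : s ∉ inner
    t∉     : t ∉ inner

open Path using (inner)

record Theta {V : Set} (G : Graph V) (s t : V) : Set where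
  field
    s≢t      : s ≢ t
    route    : Fin 3 → Path G s t
    disjoint : ∀ i j → i ≢ j → Disjoint (inner (route i)) (inner (route j))
    -- Disjointness alone would allow the edge st to serve as two of the routes.
    distinct : ∀ i j → i ≢ j → inner (route i) ≢ inner (route j)

data Piece (h : ℕ) : Set where
  branch     : Fin h → Piece h
  subdivided : Fin h → Fin h → Piece h

module Pieces {V : Set} {h : ℕ} {H : FinGraph h} {G : Graph V} (D : SubdivisionIn H G) where
  open SubdivisionIn D

  edgePath : ∀ u v (u<v : u < v) (e : Adj H u v) → Path G (φ u) (φ v)
  edgePath u v u<v e =
    mkPath (path u v u<v e) (walk u v u<v e) (unique u v u<v e)
           (avoid u v u<v e u) (avoid u v u<v e v)

  infix 4 _∈ᴾ_
  _∈ᴾ_ : V → Piece h → Set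
  x ∈ᴾ branch k       = x ≡ φ k
  x ∈ᴾ subdivided u v = Σ (u < v) λ u<v → Σ (Adj H u v) λ e → x ∈ path u v u<v e

  piece-unique : ∀ {x} P Q → x ∈ᴾ P → x ∈ᴾ Q → P ≡ Q
  piece-unique (branch k) (branch l) refl φk≡φl = cong branch (φ-inj φk≡φl)
  piece-unique (branch k) (subdivided u v) refl (u<v , e , m) = ⊥-elim (avoid u v u<v e k m)
  piece-unique (subdivided u v) (branch k) (u<v , e , m) refl = ⊥-elim (avoid u v u<v e k m)
  piece-unique (subdivided u v) (subdivided u′ v′) (p , e , m) (p′ , e′ , m′)
    with u ≟ u′ | v ≟ v′
  ... | yes refl | yes refl = refl
  ... | no u≢u′  | _        = ⊥-elim (disjoint u v p e u′ v′ p′ e′ (u≢u′ ∘ proj₁) m m′)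
  ... | _        | no v≢v′  = ⊥-elim (disjoint u v p e u′ v′ p′ e′ (v≢v′ ∘ proj₂) m m′)

-- A subdivided diamond contains a theta graph

module DiamondTheta {V : Set} {G : Graph V} (D : SubdivisionIn K4⁻ G) where
  open SubdivisionIn D
  open Pieces D

  a b c d : V
  a = φ 0F
  b = φ 1F
  c = φ 2F
  d = φ 3F

  ab : Path G a b
  ab = edgePath 0F 1F z<s e01
  ac : Path G a c
  ac = edgePath 0F 2F z<s e02
  bc : Path G b c
  bc = edgePath 1F 2F (s<s z<s) e12
  bd : Path G b d
  bd = edgePath 1F 3F (s<s z<s) e13
  cd : Path G c d
  cd = edgePath 2F 3F (s<s (s<s z<s)) e23

  via : Fin 3 → List V
  via 0F = reverse (inner ab) ++ a ∷ inner ac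
  via 1F = inner bd ++ d ∷ reverse (inner cd)
  via 2F = inner bc

  -- Every vertex lies in at most one piece, so routes made of pieces with different
  -- owners are disjoint, and b, c, whose pieces have no owner, lie on none of them.
  owner : Piece 4 → Maybe (Fin 3)
  owner (branch 0F)        = just 0F
  owner (subdivided 0F 1F) = just 0F
  owner (subdivided 0F 2F) = just 0F
  owner (branch 3F)        = just 1F
  owner (subdivided 1F 3F) = just 1F
  owner (subdivided 2F 3F) = just 1F
  owner (subdivided 1F 2F) = just 2F
  owner _                  = nothing

  via-owned : ∀ i {x} → x ∈ via i → ∃ λ P → x ∈ᴾ P × owner P ≡ just i
  via-owned 0F x∈ with ∈-++⁻ (reverse (inner ab)) x∈
  ... | inj₁ x∈ab        = subdivided 0F 1F , (z<s , e01 , reverse⁻ x∈ab) , refl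
  ... | inj₂ (here refl) = branch 0F , refl , refl
  ... | inj₂ (there x∈ac) = subdivided 0F 2F , (z<s , e02 , x∈ac) , refl
  via-owned 1F x∈ with ∈-++⁻ (inner bd) x∈
  ... | inj₁ x∈bd        = subdivided 1F 3F , (s<s z<s , e13 , x∈bd) , refl
  ... | inj₂ (here refl) = branch 3F , refl , refl
  ... | inj₂ (there x∈cd) = subdivided 2F 3F , (s<s (s<s z<s) , e23 , reverse⁻ x∈cd) , refl
  via-owned 2F x∈bc = subdivided 1F 2F , (s<s z<s , e12 , x∈bc) , refl

  via-disjoint : ∀ i j → i ≢ j → Disjoint (via i) (via j)
  via-disjoint i j i≢j x∈i x∈j with via-owned i x∈i | via-owned j x∈j
  ... | P , x∈P , P-owner | Q , x∈Q , Q-owner = i≢j (just-injective (begin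
    just i   ≡⟨ ≡.sym P-owner ⟩
    owner P  ≡⟨ cong owner (piece-unique P Q x∈P x∈Q) ⟩
    owner Q  ≡⟨ Q-owner ⟩
    just j   ∎))

  unowned∉via : ∀ k i → owner (branch k) ≡ nothing → φ k ∉ via i
  unowned∉via k i unowned φk∈ with via-owned i φk∈
  ... | P , φk∈P , P-owner with piece-unique (branch k) P refl φk∈P
  ... | refl with ≡.trans (≡.sym unowned) P-owner
  ... | ()

  via-unique : ∀ i → Unique (via i)
  via-unique 0F =
    Unique-++-∷ (Unique-reverse (Path.unique ab)) (Path.unique ac) (Path.s∉ ac) λ where
      x∈ab (here refl)  → Path.s∉ ab (reverse⁻ x∈ab)
      x∈ab (there x∈ac) → disjoint 0F 1F z<s e01 0F 2F z<s e02 (λ ()) (reverse⁻ x∈ab) x∈ac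
  via-unique 1F =
    Unique-++-∷ (Path.unique bd) (Unique-reverse (Path.unique cd))
                (Path.t∉ cd ∘ reverse⁻) λ where
      x∈bd (here refl)  → Path.t∉ bd x∈bd
      x∈bd (there x∈cd) →
        disjoint 1F 3F (s<s z<s) e13 2F 3F (s<s (s<s z<s)) e23 (λ ()) x∈bd (reverse⁻ x∈cd)
  via-unique 2F = Path.unique bc

  via-walk : ∀ i → WalkThrough G b (via i) c
  via-walk 0F =
    walk-++ G (reverse (inner ab)) (walk-reverse G (inner ab) (Path.walk ab)) (Path.walk ac)
  via-walk 1F = walk-++ G (inner bd) (Path.walk bd) (walk-reverse G (inner cd) (Path.walk cd))
  via-walk 2F = Path.walk bc

  via-distinct : ∀ i j → i ≢ j → via i ≢ via j
  via-distinct 0F j i≢j = Disjoint⇒≢ (∈-++⁺ʳ (reverse (inner ab)) (here refl)) (via-disjoint 0F j i≢j)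
  via-distinct 1F j i≢j = Disjoint⇒≢ (∈-++⁺ʳ (inner bd) (here refl)) (via-disjoint 1F j i≢j)
  via-distinct 2F 0F _   = ≢-sym (via-distinct 0F 2F λ ())
  via-distinct 2F 1F _   = ≢-sym (via-distinct 1F 2F λ ())
  via-distinct 2F 2F i≢j = ⊥-elim (i≢j refl)

  theta : Theta G b c
  theta = record
    { s≢t      = λ b≡c → case φ-inj b≡c of λ ()
    ; route    = λ i → mkPath (via i) (via-walk i) (via-unique i)
                              (unowned∉via 1F i refl) (unowned∉via 2F i refl)
    ; disjoint = via-disjoint
    ; distinct = via-distinct
    }

-- K₃,₃ from three legs

data Cross : Fin 6 → Fin 6 → Set where
  cross : (i j : Fin 3) → Cross (i ↑ˡ 3) (3 ↑ʳ j)

cross-view : ∀ u v → u < v → Adj K33 u v → Cross u v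
cross-view 0F (suc (suc (suc j))) _ _ = cross 0F j
cross-view 1F (suc (suc (suc j))) _ _ = cross 1F j
cross-view 2F (suc (suc (suc j))) _ _ = cross 2F j
cross-view (suc (suc (suc _))) 0F ()                _
cross-view (suc (suc (suc _))) 1F (s<s ())          _
cross-view (suc (suc (suc _))) 2F (s<s (s<s ()))    _
cross-view (suc (suc (suc _))) (suc (suc (suc _))) _ ¬same = ⊥-elim (¬same refl)
cross-view 0F 0F _ ¬same = ⊥-elim (¬same refl)
cross-view 0F 1F _ ¬same = ⊥-elim (¬same refl)
cross-view 0F 2F _ ¬same = ⊥-elim (¬same refl)
cross-view 1F 0F _ ¬same = ⊥-elim (¬same refl)
cross-view 1F 1F _ ¬same = ⊥-elim (¬same refl)
cross-view 1F 2F _ ¬same = ⊥-elim (¬same refl)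
cross-view 2F 0F _ ¬same = ⊥-elim (¬same refl)
cross-view 2F 1F _ ¬same = ⊥-elim (¬same refl)
cross-view 2F 2F _ ¬same = ⊥-elim (¬same refl)

-- A path from a common neighbour of p and q to r.  Three disjoint legs form a
-- subdivided K₃,₃ with sides {heads} and {p, q, r}.
record Leg {W : Set} (H : Graph W) (p q r : W) : Set where
  field
    head   : W
    tail   : List W
    head~p : Adj H head p
    head~q : Adj H head q
    walk   : WalkThrough H head tail r
    unique : Unique (head ∷ tail)
    p∉     : p ∉ head ∷ tail
    q∉     : q ∉ head ∷ tail
    r∉     : r ∉ head ∷ tail

  vertices : List W
  vertices = head ∷ tail

  head∉tail : head ∉ tail
  head∉tail with unique
  ... | head≢tail ∷ _ = All¬⇒¬Any head≢tail

  tail-unique : Unique tail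
  tail-unique with unique
  ... | _ ∷ tail! = tail!

module K33FromLegs {W : Set} {H : Graph W} {p q r : W}
  (p≢q : p ≢ q) (p≢r : p ≢ r) (q≢r : q ≢ r)
  (leg : Fin 3 → Leg H p q r)
  (legs-disjoint : ∀ i j → i ≢ j → Disjoint (Leg.vertices (leg i)) (Leg.vertices (leg j)))
  where
  open Leg

  pole : Fin 3 → W
  pole 0F = p
  pole 1F = q
  pole 2F = r

  pole-injective : Injective _≡_ _≡_ pole
  pole-injective {0F} {0F} _   = refl
  pole-injective {0F} {1F} p≡q = ⊥-elim (p≢q p≡q)
  pole-injective {0F} {2F} p≡r = ⊥-elim (p≢r p≡r)
  pole-injective {1F} {0F} q≡p = ⊥-elim (p≢q (≡.sym q≡p))
  pole-injective {1F} {1F} _   = refl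
  pole-injective {1F} {2F} q≡r = ⊥-elim (q≢r q≡r)
  pole-injective {2F} {0F} r≡p = ⊥-elim (p≢r (≡.sym r≡p))
  pole-injective {2F} {1F} r≡q = ⊥-elim (q≢r (≡.sym r≡q))
  pole-injective {2F} {2F} _   = refl

  pole∉leg : ∀ k i → pole k ∉ vertices (leg i)
  pole∉leg 0F i = p∉ (leg i)
  pole∉leg 1F i = q∉ (leg i)
  pole∉leg 2F i = r∉ (leg i)

  branchVertex : Fin 3 ⊎ Fin 3 → W
  branchVertex = [ head ∘ leg , pole ]′

  branchVertex-injective : Injective _≡_ _≡_ branchVertex
  branchVertex-injective {inj₁ i} {inj₁ j} hi≡hj with i ≟ j
  ... | yes i≡j = cong inj₁ i≡j
  ... | no i≢j  = ⊥-elim (legs-disjoint i j i≢j (here refl) (here hi≡hj))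
  branchVertex-injective {inj₁ i} {inj₂ k} hi≡pk = ⊥-elim (pole∉leg k i (here (≡.sym hi≡pk)))
  branchVertex-injective {inj₂ k} {inj₁ i} pk≡hi = ⊥-elim (pole∉leg k i (here pk≡hi))
  branchVertex-injective {inj₂ k} {inj₂ l} pk≡pl = cong inj₂ (pole-injective pk≡pl)

  φ : Fin 6 → W
  φ = branchVertex ∘ splitAt 3

  φ-injective : Injective _≡_ _≡_ φ
  φ-injective {u} {v} φu≡φv = begin
    u                      ≡⟨ join-splitAt 3 3 u ⟨
    join 3 3 (splitAt 3 u) ≡⟨ cong (join 3 3) split-u≡split-v ⟩
    join 3 3 (splitAt 3 v) ≡⟨ join-splitAt 3 3 v ⟩
    v                      ∎
    where
    split-u≡split-v : splitAt 3 u ≡ splitAt 3 v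
    split-u≡split-v = branchVertex-injective φu≡φv

  spoke : Fin 3 → Fin 3 → List W
  spoke i 0F = []
  spoke i 1F = []
  spoke i 2F = tail (leg i)

  spoke-walk : ∀ i j → WalkThrough H (head (leg i)) (spoke i j) (pole j)
  spoke-walk i 0F = head~p (leg i)
  spoke-walk i 1F = head~q (leg i)
  spoke-walk i 2F = walk (leg i)

  spoke-unique : ∀ i j → Unique (spoke i j)
  spoke-unique i 0F = []
  spoke-unique i 1F = []
  spoke-unique i 2F = tail-unique (leg i)

  spoke-avoid : ∀ i j w → branchVertex w ∉ spoke i j
  spoke-avoid i 2F (inj₁ k) hk∈ with k ≟ i
  ... | yes refl = head∉tail (leg k) hk∈
  ... | no k≢i   = legs-disjoint k i k≢i (here refl) (there hk∈)
  spoke-avoid i 2F (inj₂ k) pk∈ = pole∉leg k i (there pk∈)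
  spoke-avoid i 0F w ()
  spoke-avoid i 1F w ()

  spoke-disjoint : ∀ {i j i′ j′} → ¬ (i ≡ i′ × j ≡ j′) → Disjoint (spoke i j) (spoke i′ j′)
  spoke-disjoint {j = 0F} _ ()
  spoke-disjoint {j = 1F} _ ()
  spoke-disjoint {j = 2F} {j′ = 0F} _ _ ()
  spoke-disjoint {j = 2F} {j′ = 1F} _ _ ()
  spoke-disjoint {i} {2F} {i′} {2F} different x∈ x∈′ with i ≟ i′
  ... | yes refl = different (refl , refl)
  ... | no i≢i′  = legs-disjoint i i′ i≢i′ (there x∈) (there x∈′)

  subdivision : SubdivisionIn K33 H
  subdivision = record
    { φ        = φ
    ; φ-inj    = φ-injective
    ; path     = λ u v u<v e → spokeOf (cross-view u v u<v e)
    ; walk     = λ u v u<v e → spokeOf-walk (cross-view u v u<v e)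
    ; unique   = λ u v u<v e → spokeOf-unique (cross-view u v u<v e)
    ; avoid    = λ u v u<v e → spokeOf-avoid (cross-view u v u<v e)
    ; disjoint = λ u v u<v e u′ v′ u′<v′ e′ →
                   spokeOf-disjoint (cross-view u v u<v e) (cross-view u′ v′ u′<v′ e′)
    }
    where
    spokeOf : ∀ {u v} → Cross u v → List W
    spokeOf (cross i j) = spoke i j

    spokeOf-walk : ∀ {u v} (uv : Cross u v) → WalkThrough H (φ u) (spokeOf uv) (φ v)
    spokeOf-walk (cross i j) =
      subst (λ x → WalkThrough H x (spoke i j) (pole j))
            (cong branchVertex (≡.sym (splitAt-↑ˡ 3 i 3))) (spoke-walk i j)

    spokeOf-unique : ∀ {u v} (uv : Cross u v) → Unique (spokeOf uv)
    spokeOf-unique (cross i j) = spoke-unique i j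

    spokeOf-avoid : ∀ {u v} (uv : Cross u v) w → φ w ∉ spokeOf uv
    spokeOf-avoid (cross i j) w = spoke-avoid i j (splitAt 3 w)

    spokeOf-disjoint : ∀ {u v u′ v′} (uv : Cross u v) (uv′ : Cross u′ v′) →
                       ¬ (u ≡ u′ × v ≡ v′) → Disjoint (spokeOf uv) (spokeOf uv′)
    spokeOf-disjoint (cross i j) (cross i′ j′) different =
      spoke-disjoint {i} {j} {i′} {j′} λ { (refl , refl) → different (refl , refl) }

-- Theta graphs in the great shadow

module _ {V : Set} (G : Graph V) where

  shadow-walk : ∀ {x t} xs → WalkThrough G x xs t →
                WalkThrough (shadow G) (inj₁ x) (map inj₁ xs) (inj₂ t)
  shadow-walk []       x~t         = inj₂ (sym G x~t)
  shadow-walk (y ∷ ys) (x~y , y⋯t) = x~y , shadow-walk ys y⋯t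

  inj₂∉map-inj₁ : ∀ {v : V} (xs : List V) → inj₂ v ∉ map inj₁ xs
  inj₂∉map-inj₁ (x ∷ xs) (here ())
  inj₂∉map-inj₁ (x ∷ xs) (there v∈) = inj₂∉map-inj₁ xs v∈

  shadowLeg : ∀ {s t} → s ≢ t → Path G s t → Leg (shadow G) (inj₁ s) (inj₂ s) (inj₂ t)
  shadowLeg {t = t} s≢t (mkPath [] s~t _ _ _) = record
    { head   = inj₁ t
    ; tail   = []
    ; head~p = sym G s~t
    ; head~q = inj₂ s~t
    ; walk   = inj₁ refl
    ; unique = [] ∷ []
    ; p∉     = λ { (here s≡t) → s≢t (inj₁-injective s≡t) }
    ; q∉     = inj₂∉map-inj₁ (t ∷ [])
    ; r∉     = inj₂∉map-inj₁ (t ∷ [])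
    }
  shadowLeg s≢t (mkPath (x ∷ xs) (s~x , x⋯t) x∷xs! s∉ _) = record
    { head   = inj₁ x
    ; tail   = map inj₁ xs
    ; head~p = sym G s~x
    ; head~q = inj₂ s~x
    ; walk   = shadow-walk xs x⋯t
    ; unique = Unique.map⁺ inj₁-injective x∷xs!
    ; p∉     = s∉ ∘ ∈-map-injective⁻ inj₁-injective
    ; q∉     = inj₂∉map-inj₁ (x ∷ xs)
    ; r∉     = inj₂∉map-inj₁ (x ∷ xs)
    }

  shadowLeg-disjoint : ∀ {s t} (s≢t : s ≢ t) (P Q : Path G s t) →
                       Disjoint (inner P) (inner Q) → inner P ≢ inner Q →
                       Disjoint (Leg.vertices (shadowLeg s≢t P)) (Leg.vertices (shadowLeg s≢t Q))
  shadowLeg-disjoint _ (mkPath [] _ _ _ _) (mkPath [] _ _ _ _) _ P≢Q = ⊥-elim (P≢Q refl)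
  shadowLeg-disjoint {t = t} _ (mkPath [] _ _ _ _) (mkPath Q@(_ ∷ _) _ _ _ t∉Q) _ _ =
    Disjoint-map⁺ {xs = t ∷ []} {ys = Q} inj₁-injective λ { (here refl) → t∉Q }
  shadowLeg-disjoint {t = t} _ (mkPath P@(_ ∷ _) _ _ _ t∉P) (mkPath [] _ _ _ _) _ _ =
    Disjoint-map⁺ {xs = P} {ys = t ∷ []} inj₁-injective λ { t∈P (here refl) → t∉P t∈P }
  shadowLeg-disjoint _ (mkPath P@(_ ∷ _) _ _ _ _) (mkPath Q@(_ ∷ _) _ _ _ _) P∩Q _ =
    Disjoint-map⁺ {xs = P} {ys = Q} inj₁-injective P∩Q

theta⇒shadow-K33 : {V : Set} {G : Graph V} {s t : V} → Theta G s t → SubdivisionIn K33 (shadow G)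
theta⇒shadow-K33 {G = G} θ =
  K33FromLegs.subdivision (λ ()) (λ ()) (s≢t ∘ inj₂-injective) leg legs-disjoint
  where
  open Theta θ
  leg : Fin 3 → Leg (shadow G) _ _ _
  leg i = shadowLeg G s≢t (route i)
  legs-disjoint : ∀ i j → i ≢ j → Disjoint (Leg.vertices (leg i)) (Leg.vertices (leg j))
  legs-disjoint i j i≢j =
    shadowLeg-disjoint G s≢t (route i) (route j) (disjoint i j i≢j) (distinct i j i≢j)

lemma6 : (n : ℕ) (G : FinGraph n) → SubdivisionIn K4⁻ G → SubdivisionIn K33 (shadow G)
lemma6 n G D = theta⇒shadow-K33 (DiamondTheta.theta D)
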